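{- Let $G$ be a graph with no induced subgraph that is a $(4,\xi)$-reducible subgraph of $G$, where $\xi=2^{ -48}$. If $v\in V(G)$ is a vertex of degree $d\in\{3,4,5\}$, then $v$ has at most $d-2$ neighbors of degree $3$.
   Context: All graphs are finite and simple. For $f:V(H)\to\mathbb Z$, an $f$-assignment on $H$ assigns each $v$ a set $L(v)\subseteq\mathbb N$ with $|L(v)|=\max\{0,f(v)\}$; an $L$-coloring is a proper coloring $\phi$ with $\phi(v)\in L(v)$. For an induced subgraph $H$ of $G$, let $\ell_H(v)=4-\deg_G(v)+\deg_H(v)$ for $v\in V(H)$. $H$ is a $(4,\xi)$-reducible subgraph of $G$ if for every $\ell_H$-assignment $L$ on $H$ there is a probability distribution on $L$-colorings $\phi$ of $H$ such that (FIX) $\Pr(\phi(v)=c)\ge\xi$ for every $v\in V(H)$ and $c\in L(v)$; and (FORB) for every $U\subseteq V(H)$ with $|U|\le 2$ and every $c\in\bigcup_{u\in U}L(u)$, $\Pr(\phi(u)\ne c\ \forall u\in U)\ge\xi$. -}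

module Defs where

open import Data.Bool using (Bool; true; false; if_then_else_; _∧_; not)
open import Data.Nat as ℕ using (ℕ; zero; suc; _∸_; _^_)
open import Data.Fin using (Fin)
open import Data.List using (List; []; _∷_; length; allFin; map; _++_)
open import Data.Nat.ListAction using (sum)
open import Data.List.Relation.Unary.Unique.Propositional using (Unique)
open import Data.List.Membership.Propositional using (_∈_)
open import Data.List.Relation.Unary.All using (All)
open import Data.Product using (_×_; _,_; Σ; ∃)
open import Data.Integer using (+_)
open import Data.Rational as ℚ using (ℚ; 0ℚ; 1ℚ; _/_)
open import Relation.Binary.PropositionalEquality using (_≡_; _≢_)
open import Relation.Nullary using (does)

record Graph (n : ℕ) : Set where
  field
    adj    : Fin n → Fin n → Bool
    sym    : ∀ u v → adj u v ≡ adj v u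
    irrefl : ∀ v → adj v v ≡ false
open Graph public

count : {n : ℕ} → (Fin n → Bool) → ℕ
count {n} p = sum (map (λ w → if p w then 1 else 0) (allFin n))

deg : {n : ℕ} → Graph n → Fin n → ℕ
deg G v = count (adj G v)

-- A vertex subset S (membership as Bool) determines the induced subgraph G[S].
VSet : ℕ → Set
VSet n = Fin n → Bool

degIn : {n : ℕ} → Graph n → VSet n → Fin n → ℕ
degIn G S v = count (λ w → S w ∧ adj G v w)

-- max{0, 4 - deg_G(v) + deg_H(v)}; since deg_H ≤ deg_G this equals 4 ∸ (deg_G ∸ deg_H)
ℓ : {n : ℕ} → Graph n → VSet n → Fin n → ℕ
ℓ G S v = 4 ∸ (deg G v ∸ degIn G S v)

-- an ℓ_H-assignment: each vertex of H gets a set of exactly ℓ_H(v) natural numbers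
-- (a duplicate-free list); lists on vertices outside H are irrelevant.
IsAssignment : {n : ℕ} → Graph n → VSet n → (Fin n → List ℕ) → Set
IsAssignment G S L = ∀ v → S v ≡ true → Unique (L v) × length (L v) ≡ ℓ G S v

IsLColoring : {n : ℕ} → Graph n → VSet n → (Fin n → List ℕ) → (Fin n → ℕ) → Set
IsLColoring G S L φ =
  (∀ v → S v ≡ true → φ v ∈ L v) ×
  (∀ u v → S u ≡ true → S v ≡ true → adj G u v ≡ true → φ u ≢ φ v)

-- a finitely supported probability distribution on colorings: list of (coloring, weight)
Distribution : ℕ → Set
Distribution n = List ((Fin n → ℕ) × ℚ)

totalWeight : {n : ℕ} → Distribution n → ℚ
totalWeight [] = 0ℚ
totalWeight ((_ , p) ∷ D) = p ℚ.+ totalWeight D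

Pr : {n : ℕ} → Distribution n → ((Fin n → ℕ) → Bool) → ℚ
Pr [] E = 0ℚ
Pr ((φ , p) ∷ D) E = (if E φ then p else 0ℚ) ℚ.+ Pr D E

IsDistOnLColorings : {n : ℕ} → Graph n → VSet n → (Fin n → List ℕ) → Distribution n → Set
IsDistOnLColorings G S L D =
  All (λ { (φ , p) → IsLColoring G S L φ × 0ℚ ℚ.≤ p }) D × totalWeight D ≡ 1ℚ

ξ : ℚ
ξ = + 1 / (2 ^ 48)

-- (4,ξ)-reducibility of the induced subgraph G[S]
-- FORB: U ⊆ V(H), |U| ≤ 2 is enumerated as U = {u, w} with u, w ∈ S (u = w allowed);
-- U = ∅ is vacuous since then the union of lists is empty.
Reducible : {n : ℕ} → Graph n → VSet n → ℚ → Set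
Reducible {n} G S x =
  ∀ (L : Fin n → List ℕ) → IsAssignment G S L →
  Σ (Distribution n) λ D →
    IsDistOnLColorings G S L D ×
    (∀ v c → S v ≡ true → c ∈ L v →
       x ℚ.≤ Pr D (λ φ → does (φ v ℕ.≟ c))) ×
    (∀ u w c → S u ≡ true → S w ≡ true → c ∈ (L u ++ L w) →
       x ℚ.≤ Pr D (λ φ → not (does (φ u ℕ.≟ c)) ∧ not (does (φ w ℕ.≟ c))))

NonEmpty : {n : ℕ} → VSet n → Set
NonEmpty S = ∃ λ v → S v ≡ true

{-# OPTIONS --safe #-}
module Submission where

-- Let v have degree d ≤ 5 and let U be a set of at least d − 1 neighbours of v of degree 3,
-- and put H = G[{v} ∪ U].  Every u ∈ U has ℓ_H(u) = deg_H(u) + 1, so u can be coloured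
-- greedily at any time, and even with one colour forbidden while its neighbour v is still
-- uncoloured; and ℓ_H(v) = 4 − d + |U| ≥ 3.  Hence, for an ℓ_H-assignment L and a FIX or FORB
-- event, greedily colouring first the (at most two) vertices of U that the event constrains,
-- then v, then the rest of U gives an L-colouring realising the event.  As |V(H)| ≤ 6 and the
-- lists have at most 4 colours, there are at most 6·4 + 6·6·8 = 312 events, and the uniform
-- distribution on the corresponding colourings shows that H is (4, 1/312)-reducible, hence
-- (4, 2^-48)-reducible.

open import Defs hiding (sym)
open import Data.Nat as ℕ using (ℕ; zero; suc; _+_; _<_; _≤_; _∸_; _≡ᵇ_; z≤n; s≤s)
open import Data.Fin using (Fin)
open import Data.Bool as Bool using (Bool; true; false; _∧_; _∨_; not; if_then_else_)
open import Data.Sum using (_⊎_; inj₁; inj₂)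
open import Relation.Nullary using (¬_; Dec; yes; no; does; ¬?; contradiction)
open import Relation.Binary.PropositionalEquality using (_≡_; _≢_; refl; sym; trans; cong; cong₂; subst; subst₂; module ≡-Reasoning)

open import Data.Bool.Properties using (∧-conicalˡ; ∧-conicalʳ; ∨-zeroʳ; T-≡)
open import Data.Fin.Properties using (_≟_)
open import Data.Integer as ℤ using (+_)
open import Data.Integer.Properties using (pos-*; *-comm; *-identityˡ)
open import Data.Integer.Solver using (module +-*-Solver)
open import Data.List using (List; []; _∷_; [_]; length; map; filter; allFin; _++_; concat)
open import Data.List.Membership.Propositional using (_∈_; _∉_; find; lose; mapWith∈)
open import Data.List.Membership.Propositional.Properties using (∈-filter⁺; ∈-filter⁻; ∈-allFin; ∈-++⁺ˡ; ∈-++⁺ʳ; ∈-map⁺)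
open import Data.List.Properties using (filter-notAll; length-++; length-map)
open import Data.List.Relation.Binary.Subset.Propositional using (_⊆_)
open import Data.List.Relation.Unary.All as All using (All; []; _∷_)
open import Data.List.Relation.Unary.Any as Any using (Any; here; there; any?)
import Data.List.Relation.Unary.Any.Properties as Any
open import Data.List.Relation.Unary.Unique.Propositional using (Unique; []; _∷_)
open import Data.List.Relation.Unary.Unique.Propositional.Properties using (filter⁺; allFin⁺)
open import Data.Nat.Coprimality using (1-coprimeTo)
open import Data.Nat.ListAction using (sum)
open import Data.Nat.Properties as ℕP using (≤-trans; <⇒≱; m∸n≤m)
open import Data.Product using (Σ; ∃; ∃₂; _×_; _,_; proj₁; proj₂)
open import Data.Rational as ℚ using (ℚ; mkℚ; 0ℚ; 1ℚ; toℚᵘ)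
open import Algebra.Definitions.RawMonoid ℚ.+-0-rawMonoid using () renaming (_×_ to _×ℚ_)
open import Data.Rational.Properties as ℚP using (toℚᵘ-homo-+; toℚᵘ-injective)
open import Data.Rational.Unnormalised as ℚᵘ using (mkℚᵘ; *≡*)
open import Data.Rational.Unnormalised.Properties using (≃-trans; +-congʳ)
open import Data.Unit using (tt)
open import Data.Vec.Functional using (updateAt)
open import Data.Vec.Functional.Properties using (updateAt-updates; updateAt-minimal)
open import Function using (_∘_; case_of_)
open import Function.Bundles using (Equivalence)
open import Relation.Binary.Definitions using (DecidableEquality)
open import Relation.Nullary.Decidable using (decidable-stable; dec-true; dec-false)

module _ {A : Set} (_≟ᴬ_ : DecidableEquality A) where
  open import Data.List.Membership.DecPropositional _≟ᴬ_ using (_∈?_)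

  unique-⊆⇒length-≤ : ∀ {xs ys : List A} → Unique xs → xs ⊆ ys → length xs ≤ length ys
  unique-⊆⇒length-≤ {[]} _ _ = z≤n
  unique-⊆⇒length-≤ {x ∷ xs} {ys} (x∉xs ∷ xs!) xs⊆ys = begin-strict
    length xs               ≤⟨ unique-⊆⇒length-≤ xs! xs⊆ys-x ⟩
    length (filter ≢x? ys)  <⟨ filter-notAll ≢x? ys (Any.map (λ { refl x≢x → x≢x refl }) (xs⊆ys (here refl))) ⟩
    length ys               ∎
    where
      open ℕP.≤-Reasoning
      ≢x? : ∀ y → Dec (y ≢ x)
      ≢x? y = ¬? (y ≟ᴬ x)
      xs⊆ys-x : xs ⊆ filter ≢x? ys
      xs⊆ys-x y∈xs = ∈-filter⁺ ≢x? (xs⊆ys (there y∈xs)) (λ { refl → All.lookup x∉xs y∈xs refl })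

  length<⇒∃∉ : ∀ {xs ys : List A} → Unique xs → length ys < length xs → ∃ λ x → x ∈ xs × x ∉ ys
  length<⇒∃∉ {xs} {ys} xs! ys<xs with any? (λ x → ¬? (x ∈? ys)) xs
  ... | yes some∉ = find some∉
  ... | no none∉ = contradiction (unique-⊆⇒length-≤ xs! xs⊆ys) (<⇒≱ ys<xs)
    where
      xs⊆ys : xs ⊆ ys
      xs⊆ys {x} x∈xs = decidable-stable (x ∈? ys) (none∉ ∘ lose x∈xs)

module _ {A : Set} where

  1≤length⇒∃∈ : ∀ {xs : List A} → 1 ≤ length xs → ∃ (_∈ xs)
  1≤length⇒∃∈ {x ∷ _} _ = x , here refl

  Any⇒≢[] : ∀ {P : A → Set} {xs} → Any P xs → xs ≢ []
  Any⇒≢[] (here _) ()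
  Any⇒≢[] (there _) ()

module _ {A B : Set} where

  concatWith∈ : (xs : List A) → (∀ {x} → x ∈ xs → List B) → List B
  concatWith∈ xs f = concat (mapWith∈ xs f)

  length-concatWith∈-≤ : ∀ {k} xs (f : ∀ {x} → x ∈ xs → List B) →
                         (∀ {x} (x∈xs : x ∈ xs) → length (f x∈xs) ≤ k) →
                         length (concatWith∈ xs f) ≤ length xs ℕ.* k
  length-concatWith∈-≤ [] f bound = z≤n
  length-concatWith∈-≤ (x ∷ xs) f bound = ≤-trans (ℕP.≤-reflexive (length-++ (f (here refl))))
    (ℕP.+-mono-≤ (bound (here refl)) (length-concatWith∈-≤ xs (f ∘ there) (bound ∘ there)))

  Any-concatWith∈⁺ : ∀ {P : B → Set} xs (f : ∀ {x} → x ∈ xs → List B) {x} (x∈xs : x ∈ xs) →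
                     Any P (f x∈xs) → Any P (concatWith∈ xs f)
  Any-concatWith∈⁺ xs f x∈xs p = Any.concat⁺ (Any.mapWith∈⁺ f (_ , x∈xs , p))

infix 4 _⊆ᵛ_
infixr 7 _∩_
infixr 6 _∪_

_⊆ᵛ_ : ∀ {n} → VSet n → VSet n → Set
P ⊆ᵛ Q = ∀ y → P y ≡ true → Q y ≡ true

_∩_ _∪_ : ∀ {n} → VSet n → VSet n → VSet n
(P ∩ Q) y = P y ∧ Q y
(P ∪ Q) y = P y ∨ Q y

∁_ : ∀ {n} → VSet n → VSet n
(∁ P) y = not (P y)

∅ : ∀ {n} → VSet n
∅ _ = false

｛_｝ : ∀ {n} → Fin n → VSet n
｛ x ｝ y = does (y ≟ x)

module _ {n : ℕ} where

  ∪-introˡ : ∀ (P Q : VSet n) → P ⊆ᵛ P ∪ Q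
  ∪-introˡ P Q y Py rewrite Py = refl

  ∪-introʳ : ∀ (P Q : VSet n) → Q ⊆ᵛ P ∪ Q
  ∪-introʳ P Q y Qy rewrite Qy = ∨-zeroʳ (P y)

  ∪-least : ∀ {P Q R : VSet n} → P ⊆ᵛ R → Q ⊆ᵛ R → P ∪ Q ⊆ᵛ R
  ∪-least {P} P⊆R Q⊆R y PQy with P y in Py
  ... | true = P⊆R y Py
  ... | false = Q⊆R y PQy

  ∩-elimˡ : ∀ (P Q : VSet n) → P ∩ Q ⊆ᵛ P
  ∩-elimˡ P Q y = ∧-conicalˡ (P y) (Q y)

  ∩-elimʳ : ∀ (P Q : VSet n) → P ∩ Q ⊆ᵛ Q
  ∩-elimʳ P Q y = ∧-conicalʳ (P y) (Q y)

  ∩-greatest : ∀ {P Q R : VSet n} → P ⊆ᵛ Q → P ⊆ᵛ R → P ⊆ᵛ Q ∩ R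
  ∩-greatest P⊆Q P⊆R y Py = cong₂ _∧_ (P⊆Q y Py) (P⊆R y Py)

  ∩-∁-split : ∀ (P Q : VSet n) → P ⊆ᵛ (P ∩ Q) ∪ (P ∩ ∁ Q)
  ∩-∁-split P Q y Py rewrite Py with Q y
  ... | true = refl
  ... | false = refl

  ∈-∁ : ∀ (P : VSet n) y → (∁ P) y ≡ true → P y ≡ false
  ∈-∁ P y ∁Py with P y
  ... | false = refl

  x∈｛x｝ : ∀ (x : Fin n) → ｛ x ｝ x ≡ true
  x∈｛x｝ x = dec-true (x ≟ x) refl

  ∈-｛｝ : ∀ (x y : Fin n) → ｛ x ｝ y ≡ true → y ≡ x
  ∈-｛｝ x y y∈ with y ≟ x
  ... | yes y≡x = y≡x

  ∉-｛｝ : ∀ (x y : Fin n) → ｛ x ｝ y ≡ false → y ≢ x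
  ∉-｛｝ x y y∉ refl = contradiction (trans (sym (x∈｛x｝ x)) y∉) λ ()

  ｛｝-⊆ : ∀ (x : Fin n) {W : VSet n} → W x ≡ true → ｛ x ｝ ⊆ᵛ W
  ｛｝-⊆ x {W} Wx y y∈ = subst (λ z → W z ≡ true) (sym (∈-｛｝ x y y∈)) Wx

  ∈-｛｝∪ : ∀ (x : Fin n) D y → (｛ x ｝ ∪ D) y ≡ true → y ≡ x ⊎ (y ≢ x × D y ≡ true)
  ∈-｛｝∪ x D y y∈ with y ≟ x
  ... | yes y≡x = inj₁ y≡x
  ... | no y≢x = inj₂ (y≢x , y∈)

  members : VSet n → List (Fin n)
  members P = filter (λ y → P y Bool.≟ true) (allFin n)

  ∈-members⁺ : ∀ {P y} → P y ≡ true → y ∈ members P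
  ∈-members⁺ {P} {y} = ∈-filter⁺ (λ y → P y Bool.≟ true) (∈-allFin y)

  ∈-members⁻ : ∀ {P y} → y ∈ members P → P y ≡ true
  ∈-members⁻ {P} = proj₂ ∘ ∈-filter⁻ (λ y → P y Bool.≟ true) {xs = allFin n}

  members-unique : ∀ P → Unique (members P)
  members-unique P = filter⁺ (λ y → P y Bool.≟ true) (allFin⁺ n)

  count≡length-members : ∀ P → count P ≡ length (members P)
  count≡length-members P = go (allFin n)
    where
      go : ∀ ys → sum (map (λ w → if P w then 1 else 0) ys) ≡ length (filter (λ y → P y Bool.≟ true) ys)
      go [] = refl
      go (y ∷ ys) with P y
      ... | true = cong suc (go ys)
      ... | false = go ys

  length≤count : ∀ {P ys} → Unique ys → (∀ {y} → y ∈ ys → P y ≡ true) → length ys ≤ count P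
  length≤count {P} ys! ys⊆P rewrite count≡length-members P =
    unique-⊆⇒length-≤ _≟_ ys! (∈-members⁺ ∘ ys⊆P)

  count≤length : ∀ {P ys} → (∀ y → P y ≡ true → y ∈ ys) → count P ≤ length ys
  count≤length {P} P⊆ys rewrite count≡length-members P =
    unique-⊆⇒length-≤ _≟_ (members-unique P) (P⊆ys _ ∘ ∈-members⁻)

  count-mono-≤ : ∀ {P Q} → P ⊆ᵛ Q → count P ≤ count Q
  count-mono-≤ {P} P⊆Q rewrite count≡length-members P =
    length≤count (members-unique P) (P⊆Q _ ∘ ∈-members⁻)

  count-mono-< : ∀ {P Q a} → P ⊆ᵛ Q → P a ≡ false → Q a ≡ true → count P < count Q
  count-mono-< {P} {Q} {a} P⊆Q Pa Qa rewrite count≡length-members P =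
    length≤count (a∉P ∷ members-unique P) a∷P⊆Q
    where
      a∉P : All (a ≢_) (members P)
      a∉P = All.tabulate λ { y∈P refl → contradiction (trans (sym Pa) (∈-members⁻ y∈P)) λ () }
      a∷P⊆Q : ∀ {y} → y ∈ a ∷ members P → Q y ≡ true
      a∷P⊆Q (here refl) = Qa
      a∷P⊆Q (there y∈P) = P⊆Q _ (∈-members⁻ y∈P)

module ListColouring {n : ℕ} (G : Graph n) (M A : Fin n → List ℕ) where

  record IsColouringOn (φ : Fin n → ℕ) (D : VSet n) : Set where
    constructor colouring
    field
      from-lists : ∀ y → D y ≡ true → φ y ∈ M y × φ y ∉ A y
      proper     : ∀ y z → D y ≡ true → D z ≡ true → adj G y z ≡ true → φ y ≢ φ z

  HasSpareColour : Fin n → VSet n → Set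
  HasSpareColour x D = Unique (M x) × length (A x) + count (D ∩ adj G x) < length (M x)

  restrict : ∀ {φ D D′} → D ⊆ᵛ D′ → IsColouringOn φ D′ → IsColouringOn φ D
  restrict D⊆D′ (colouring φ∈M∖A φ-proper) =
    colouring (λ y → φ∈M∖A y ∘ D⊆D′ y) λ y z Dy Dz → φ-proper y z (D⊆D′ y Dy) (D⊆D′ z Dz)

  colouring-∅ : ∀ φ → IsColouringOn φ ∅
  colouring-∅ φ = colouring (λ _ ()) λ _ _ ()

  isLColoring : ∀ {S L φ} → (∀ y → S y ≡ true → M y ⊆ L y) → IsColouringOn φ S → IsLColoring G S L φ
  isLColoring M⊆L (colouring from-lists proper) = (λ y Sy → M⊆L y Sy (proj₁ (from-lists y Sy))) , proper

  colour-vertex : ∀ {φ D x} → IsColouringOn φ D → HasSpareColour x D → ∃ λ φ′ → IsColouringOn φ′ (｛ x ｝ ∪ D)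
  colour-vertex {φ} {D} {x} (colouring φ∈M∖A φ-proper) (M! , spare) = φ′ , colouring φ′∈M∖A φ′-proper
    where
      neighbourColours : List ℕ
      neighbourColours = map φ (members (D ∩ adj G x))

      F : List ℕ
      F = A x ++ neighbourColours

      |F| : length F ≡ length (A x) + count (D ∩ adj G x)
      |F| = begin
        length (A x ++ neighbourColours)                ≡⟨ length-++ (A x) ⟩
        length (A x) + length neighbourColours          ≡⟨ cong (length (A x) ℕ.+_) (length-map φ (members (D ∩ adj G x))) ⟩
        length (A x) + length (members (D ∩ adj G x))   ≡⟨ cong (length (A x) ℕ.+_) (count≡length-members (D ∩ adj G x)) ⟨
        length (A x) + count (D ∩ adj G x)              ∎
        where open ≡-Reasoning

      picked : ∃ λ c → c ∈ M x × c ∉ F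
      picked = length<⇒∃∉ ℕ._≟_ M! (subst (_< length (M x)) (sym |F|) spare)

      c : ℕ
      c = proj₁ picked

      c≢neighbour : ∀ z → D z ≡ true → adj G x z ≡ true → c ≢ φ z
      c≢neighbour z Dz xz c≡φz = proj₂ (proj₂ picked)
        (∈-++⁺ʳ (A x) (subst (_∈ neighbourColours) (sym c≡φz) (∈-map⁺ φ (∈-members⁺ (cong₂ _∧_ Dz xz)))))

      φ′ : Fin n → ℕ
      φ′ = updateAt φ x (λ _ → c)

      φ′∈M∖A : ∀ y → (｛ x ｝ ∪ D) y ≡ true → φ′ y ∈ M y × φ′ y ∉ A y
      φ′∈M∖A y y∈ with ∈-｛｝∪ x D y y∈
      ... | inj₁ refl rewrite updateAt-updates x {λ _ → c} φ =
        proj₁ (proj₂ picked) , proj₂ (proj₂ picked) ∘ ∈-++⁺ˡ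
      ... | inj₂ (y≢x , Dy) rewrite updateAt-minimal y x {λ _ → c} φ y≢x = φ∈M∖A y Dy

      φ′-proper : ∀ y z → (｛ x ｝ ∪ D) y ≡ true → (｛ x ｝ ∪ D) z ≡ true → adj G y z ≡ true → φ′ y ≢ φ′ z
      φ′-proper y z y∈ z∈ yz with ∈-｛｝∪ x D y y∈ | ∈-｛｝∪ x D z z∈
      ... | inj₁ refl | inj₁ refl = contradiction (trans (sym yz) (irrefl G x)) λ ()
      ... | inj₁ refl | inj₂ (z≢x , Dz)
        rewrite updateAt-updates x {λ _ → c} φ | updateAt-minimal z x {λ _ → c} φ z≢x = c≢neighbour z Dz yz
      ... | inj₂ (y≢x , Dy) | inj₁ refl
        rewrite updateAt-updates x {λ _ → c} φ | updateAt-minimal y x {λ _ → c} φ y≢x =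
        c≢neighbour y Dy (trans (Graph.sym G x y) yz) ∘ sym
      ... | inj₂ (y≢x , Dy) | inj₂ (z≢x , Dz)
        rewrite updateAt-minimal y x {λ _ → c} φ y≢x | updateAt-minimal z x {λ _ → c} φ z≢x = φ-proper y z Dy Dz yz

  -- The spare colour is required against every coloured set inside W, so P may be coloured in any order.
  colour-set : ∀ {P W D φ} → P ⊆ᵛ W → (∀ x → P x ≡ true → ∀ {D′} → D′ ⊆ᵛ W → HasSpareColour x D′) →
               D ⊆ᵛ W → IsColouringOn φ D → ∃ λ φ′ → IsColouringOn φ′ (D ∪ P)
  colour-set {P} {W} P⊆W spare D⊆W φ-col =
    let φ′ , D′ , φ′-col , D⊆D′ , P⊆D′ = go (members P) (∈-members⁻ {P = P}) D⊆W φ-col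
    in φ′ , restrict (∪-least D⊆D′ λ y → P⊆D′ ∘ ∈-members⁺) φ′-col
    where
      go : ∀ xs {D φ} → (∀ {x} → x ∈ xs → P x ≡ true) → D ⊆ᵛ W → IsColouringOn φ D →
           ∃₂ λ φ′ D′ → IsColouringOn φ′ D′ × D ⊆ᵛ D′ × (∀ {x} → x ∈ xs → D′ x ≡ true)
      go [] _ _ φ-col = _ , _ , φ-col , (λ _ Dy → Dy) , λ ()
      go (x ∷ xs) {D} xs⊆P D⊆W φ-col =
        let Px = xs⊆P (here refl)
            φ₁ , φ₁-col = colour-vertex φ-col (spare x Px D⊆W)
            φ′ , D′ , φ′-col , D₁⊆D′ , xs⊆D′ =
              go xs {｛ x ｝ ∪ D} (xs⊆P ∘ there) (∪-least (｛｝-⊆ x (P⊆W x Px)) D⊆W) φ₁-col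
        in φ′ , D′ , φ′-col , (λ y → D₁⊆D′ y ∘ ∪-introʳ ｛ x ｝ D y)
         , λ { (here refl) → D₁⊆D′ x (∪-introˡ ｛ x ｝ D x (x∈｛x｝ x)) ; (there x∈xs) → xs⊆D′ x∈xs }

1/[1+_] : ℕ → ℚ
1/[1+ m ] = mkℚ (+ 1) m (1-coprimeTo (suc m))

1/[1+]-nonneg : ∀ m → 0ℚ ℚ.≤ 1/[1+ m ]
1/[1+]-nonneg m = ℚ.*≤* (ℤ.+≤+ z≤n)

1/[1+]-antimono : ∀ {k m} → k ≤ m → 1/[1+ m ] ℚ.≤ 1/[1+ k ]
1/[1+]-antimono k≤m = ℚ.*≤* (subst₂ ℤ._≤_ (sym (*-identityˡ _)) (sym (*-identityˡ _)) (ℤ.+≤+ (s≤s k≤m)))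

k×1/[1+m]≃k/[1+m] : ∀ m k → toℚᵘ (k ×ℚ 1/[1+ m ]) ℚᵘ.≃ mkℚᵘ (+ k) m
k×1/[1+m]≃k/[1+m] m zero = *≡* refl
k×1/[1+m]≃k/[1+m] m (suc k) = ≃-trans (toℚᵘ-homo-+ 1/[1+ m ] (k ×ℚ 1/[1+ m ]))
  (≃-trans (+-congʳ (mkℚᵘ (+ 1) m) (k×1/[1+m]≃k/[1+m] m k)) 1/[1+m]+k/[1+m])
  where
    open +-*-Solver
    1/[1+m]+k/[1+m] : mkℚᵘ (+ 1) m ℚᵘ.+ mkℚᵘ (+ k) m ℚᵘ.≃ mkℚᵘ (+ suc k) m
    1/[1+m]+k/[1+m] = *≡* (trans
      (solve 2 (λ k N → (con (+ 1) :* N :+ k :* N) :* N := (con (+ 1) :+ k) :* (N :* N)) refl (+ k) (+ suc m))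
      (cong (+ suc k ℤ.*_) (sym (pos-* (suc m) (suc m)))))

[1+m]×1/[1+m]≡1 : ∀ m → suc m ×ℚ 1/[1+ m ] ≡ 1ℚ
[1+m]×1/[1+m]≡1 m = toℚᵘ-injective (≃-trans (k×1/[1+m]≃k/[1+m] m (suc m)) (*≡* (*-comm (+ suc m) (+ 1))))

module _ {n : ℕ} (w : ℚ) where

  weighted : List (Fin n → ℕ) → Distribution n
  weighted = map (_, w)

  totalWeight-weighted : ∀ φs → totalWeight (weighted φs) ≡ length φs ×ℚ w
  totalWeight-weighted [] = refl
  totalWeight-weighted (φ ∷ φs) = cong (w ℚ.+_) (totalWeight-weighted φs)

  module _ (0≤w : 0ℚ ℚ.≤ w) (E : (Fin n → ℕ) → Bool) where

    weight-nonneg : ∀ b → 0ℚ ℚ.≤ (if b then w else 0ℚ)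
    weight-nonneg true = 0≤w
    weight-nonneg false = ℚP.≤-refl

    Pr-weighted-nonneg : ∀ φs → 0ℚ ℚ.≤ Pr (weighted φs) E
    Pr-weighted-nonneg [] = ℚP.≤-refl
    Pr-weighted-nonneg (φ ∷ φs) = ℚP.+-mono-≤ (weight-nonneg (E φ)) (Pr-weighted-nonneg φs)

    Pr-weighted-≥ : ∀ {φs} → Any (λ φ → E φ ≡ true) φs → w ℚ.≤ Pr (weighted φs) E
    Pr-weighted-≥ {φ ∷ φs} (here Eφ) rewrite Eφ = begin
      w                          ≡⟨ ℚP.+-identityʳ w ⟨
      w ℚ.+ 0ℚ                   ≤⟨ ℚP.+-monoʳ-≤ w (Pr-weighted-nonneg φs) ⟩
      w ℚ.+ Pr (weighted φs) E   ∎
      where open ℚP.≤-Reasoning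
    Pr-weighted-≥ {φ ∷ φs} (there Eφs) = begin
      w                                                ≤⟨ Pr-weighted-≥ Eφs ⟩
      Pr (weighted φs) E                               ≡⟨ ℚP.+-identityˡ _ ⟨
      0ℚ ℚ.+ Pr (weighted φs) E                        ≤⟨ ℚP.+-monoˡ-≤ _ (weight-nonneg (E φ)) ⟩
      (if E φ then w else 0ℚ) ℚ.+ Pr (weighted φs) E   ∎
      where open ℚP.≤-Reasoning

LColouring : ∀ {n} → Graph n → VSet n → (Fin n → List ℕ) → Set
LColouring {n} G S L = Σ (Fin n → ℕ) (IsLColoring G S L)

record CoveringFamily {n} (G : Graph n) (S : VSet n) (L : Fin n → List ℕ) (m : ℕ) : Set where
  field
    colourings : List (LColouring G S L)
    nonempty   : colourings ≢ []
    size       : length colourings ≤ suc m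
    fixing     : ∀ v c → S v ≡ true → c ∈ L v → Any (λ φ → proj₁ φ v ≡ c) colourings
    forbidding : ∀ u w c → S u ≡ true → S w ≡ true → c ∈ L u ++ L w →
                 Any (λ φ → proj₁ φ u ≢ c × proj₁ φ w ≢ c) colourings

reducible-from-covering : ∀ {n} {G : Graph n} {S : VSet n} m →
                          (∀ L → IsAssignment G S L → CoveringFamily G S L m) → Reducible G S 1/[1+ m ]
reducible-from-covering {n} {G} {S} m family L L-assignment with family L L-assignment
... | record { colourings = [] ; nonempty = nonempty } = contradiction refl nonempty
... | record { colourings = Φ@(_ ∷ Φ′) ; size = s≤s |Φ′|≤m ; fixing = fixing ; forbidding = forbidding } =
  weighted w φs , (valid Φ , total) , fix , forbid
  where
    w : ℚ
    w = 1/[1+ length Φ′ ]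

    φs : List (Fin n → ℕ)
    φs = map proj₁ Φ

    valid : ∀ Ψ → All (λ { (φ , p) → IsLColoring G S L φ × 0ℚ ℚ.≤ p }) (weighted w (map proj₁ Ψ))
    valid [] = []
    valid ((_ , φ-colouring) ∷ Ψ) = (φ-colouring , 1/[1+]-nonneg (length Φ′)) ∷ valid Ψ

    total : totalWeight (weighted w φs) ≡ 1ℚ
    total = trans (totalWeight-weighted w φs) (trans (cong (_×ℚ w) (length-map proj₁ Φ)) ([1+m]×1/[1+m]≡1 (length Φ′)))

    fix : ∀ v c → S v ≡ true → c ∈ L v → 1/[1+ m ] ℚ.≤ Pr (weighted w φs) (λ φ → does (φ v ℕ.≟ c))
    fix v c Sv c∈Lv = ℚP.≤-trans (1/[1+]-antimono |Φ′|≤m)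
      (Pr-weighted-≥ w (1/[1+]-nonneg _) (λ φ → does (φ v ℕ.≟ c))
        (Any.map⁺ {f = proj₁} (Any.map (dec-true (_ ℕ.≟ c)) (fixing v c Sv c∈Lv))))

    forbid : ∀ u v c → S u ≡ true → S v ≡ true → c ∈ L u ++ L v →
             1/[1+ m ] ℚ.≤ Pr (weighted w φs) (λ φ → not (does (φ u ℕ.≟ c)) ∧ not (does (φ v ℕ.≟ c)))
    forbid u v c Su Sv c∈ = ℚP.≤-trans (1/[1+]-antimono |Φ′|≤m)
      (Pr-weighted-≥ w (1/[1+]-nonneg _) (λ φ → not (does (φ u ℕ.≟ c)) ∧ not (does (φ v ℕ.≟ c)))
        (Any.map⁺ {f = proj₁} (Any.map (λ (φu≢c , φv≢c) → cong₂ _∧_ (cong not (dec-false (_ ℕ.≟ c) φu≢c))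
                                                                     (cong not (dec-false (_ ℕ.≟ c) φv≢c)))
                                         (forbidding u v c Su Sv c∈))))

reducible-mono : ∀ {n} {G : Graph n} {S : VSet n} {x y} → y ℚ.≤ x → Reducible G S x → Reducible G S y
reducible-mono y≤x reducible L L-assignment =
  let D , distribution , fix , forbid = reducible L L-assignment
  in D , distribution , (λ v c Sv c∈ → ℚP.≤-trans y≤x (fix v c Sv c∈))
                      , (λ u w c Su Sw c∈ → ℚP.≤-trans y≤x (forbid u w c Su Sw c∈))

4∸[3∸d]≡1+d : ∀ {d} → d ≤ 3 → 4 ∸ (3 ∸ d) ≡ suc d
4∸[3∸d]≡1+d {d} d≤3 = begin
  1 + 3 ∸ (3 ∸ d)     ≡⟨ ℕP.+-∸-assoc 1 (m∸n≤m 3 d) ⟩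
  1 + (3 ∸ (3 ∸ d))   ≡⟨ cong suc (ℕP.m∸[m∸n]≡n d≤3) ⟩
  suc d               ∎
  where open ≡-Reasoning

3≤4∸[d∸e] : ∀ {d e} → d ∸ 1 ≤ e → 3 ≤ 4 ∸ (d ∸ e)
3≤4∸[d∸e] {d} d∸1≤e = ℕP.∸-monoʳ-≤ 4 (≤-trans (ℕP.∸-monoʳ-≤ d d∸1≤e) (d∸[d∸1]≤1 d))
  where
    d∸[d∸1]≤1 : ∀ d → d ∸ (d ∸ 1) ≤ 1
    d∸[d∸1]≤1 zero = z≤n
    d∸[d∸1]≤1 (suc d) = ℕP.≤-reflexive (ℕP.m+n∸n≡m 1 d)

module CubicNeighbours {n} (G : Graph n) (v : Fin n) (U : VSet n)
  (U⊆N : U ⊆ᵛ adj G v) (U-cubic : ∀ u → U u ≡ true → deg G u ≡ 3)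
  (U-large : deg G v ∸ 1 ≤ count U) (deg-v≤5 : deg G v ≤ 5) where

  S : VSet n
  S = ｛ v ｝ ∪ U

  v∉U : U v ≡ false
  v∉U with U v in Uv
  ... | true = contradiction (trans (sym (U⊆N v Uv)) (irrefl G v)) λ ()
  ... | false = refl

  v∈S : S v ≡ true
  v∈S = ∪-introˡ ｛ v ｝ U v (x∈｛x｝ v)

  U⊆S : U ⊆ᵛ S
  U⊆S = ∪-introʳ ｛ v ｝ U

  ℓ-U : ∀ u → U u ≡ true → ℓ G S u ≡ suc (degIn G S u)
  ℓ-U u Uu rewrite U-cubic u Uu =
    4∸[3∸d]≡1+d (subst (degIn G S u ≤_) (U-cubic u Uu) (count-mono-≤ (∩-elimʳ S (adj G u))))

  ℓ-v : 3 ≤ ℓ G S v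
  ℓ-v = 3≤4∸[d∸e] (≤-trans U-large (count-mono-≤ (∩-greatest U⊆S U⊆N)))

  coloured-≤-degIn : ∀ {D} y → D ⊆ᵛ S → count (D ∩ adj G y) ≤ degIn G S y
  coloured-≤-degIn {D} y D⊆S =
    count-mono-≤ (∩-greatest (λ z → D⊆S z ∘ ∩-elimˡ D (adj G y) z) (∩-elimʳ D (adj G y)))

  coloured-<-degIn : ∀ {D} u → U u ≡ true → D ⊆ᵛ U → count (D ∩ adj G u) < degIn G S u
  coloured-<-degIn {D} u Uu D⊆U =
    count-mono-< (∩-greatest (λ z → U⊆S z ∘ D⊆U z ∘ ∩-elimˡ D (adj G u) z) (∩-elimʳ D (adj G u)))
                 v∉D∩N (cong₂ _∧_ v∈S (trans (Graph.sym G u v) (U⊆N u Uu)))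
    where
      v∉D∩N : (D ∩ adj G u) v ≡ false
      v∉D∩N with D v in Dv
      ... | true = contradiction (trans (sym (D⊆U v Dv)) v∉U) λ ()
      ... | false = refl

  module _ (L : Fin n → List ℕ) (L-assignment : IsAssignment G S L) where

    L! : ∀ y → S y ≡ true → Unique (L y)
    L! y Sy = proj₁ (L-assignment y Sy)

    |L| : ∀ y → S y ≡ true → length (L y) ≡ ℓ G S y
    |L| y Sy = proj₂ (L-assignment y Sy)

    |L|≤4 : ∀ y → S y ≡ true → length (L y) ≤ 4
    |L|≤4 y Sy rewrite |L| y Sy = m∸n≤m 4 (deg G y ∸ degIn G S y)

    |L-U| : ∀ u → U u ≡ true → length (L u) ≡ suc (degIn G S u)
    |L-U| u Uu = trans (|L| u (U⊆S u Uu)) (ℓ-U u Uu)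

    3≤|L-v| : 3 ≤ length (L v)
    3≤|L-v| rewrite |L| v v∈S = ℓ-v

    colour-in-phases : ∀ T M A → let open ListColouring G M A in
      (∀ y → (U ∩ T) y ≡ true → ∀ {D} → D ⊆ᵛ U ∩ T → HasSpareColour y D) →
      (∀ {D} → D ⊆ᵛ U ∩ T → HasSpareColour v D) →
      (∀ y → T y ≡ false → M y ≡ L y × A y ≡ []) →
      ∃ λ φ → IsColouringOn φ S
    colour-in-phases T M A spare-T spare-v rest =
      let φ₁ , φ₁-col = colour-set (λ _ U∩T → U∩T) spare-T (λ _ ()) (colouring-∅ (λ _ → 0))
          φ₂ , φ₂-col = colour-vertex φ₁-col (spare-v D₁⊆U∩T)
          φ₃ , φ₃-col = colour-set (λ y → U⊆S y ∘ ∩-elimˡ U (∁ T) y) spare-rest D₂⊆S φ₂-col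
      in φ₃ , restrict S⊆D₃ φ₃-col
      where
        open ListColouring G M A
        D₁ D₂ : VSet n
        D₁ = ∅ ∪ (U ∩ T)
        D₂ = ｛ v ｝ ∪ D₁

        D₁⊆U∩T : D₁ ⊆ᵛ U ∩ T
        D₁⊆U∩T = ∪-least (λ _ ()) (λ _ U∩T → U∩T)

        D₂⊆S : D₂ ⊆ᵛ S
        D₂⊆S = ∪-least (｛｝-⊆ v v∈S) (λ y → U⊆S y ∘ ∩-elimˡ U T y ∘ D₁⊆U∩T y)

        spare-rest : ∀ y → (U ∩ ∁ T) y ≡ true → ∀ {D} → D ⊆ᵛ S → HasSpareColour y D
        spare-rest y y∈ {D} D⊆S
          with Uy ← ∩-elimˡ U (∁ T) y y∈ | rest y (∈-∁ T y (∩-elimʳ U (∁ T) y y∈))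
        ... | M≡L , A≡[] rewrite M≡L | A≡[] | |L-U| y Uy = L! y (U⊆S y Uy) , s≤s (coloured-≤-degIn y D⊆S)

        S⊆D₃ : S ⊆ᵛ D₂ ∪ (U ∩ ∁ T)
        S⊆D₃ = ∪-least (｛｝-⊆ v (∪-introˡ D₂ (U ∩ ∁ T) v (∪-introˡ ｛ v ｝ D₁ v (x∈｛x｝ v))))
                       (λ y → ∪-least U∩T⊆D₃ (∪-introʳ D₂ (U ∩ ∁ T)) y ∘ ∩-∁-split U T y)
          where
            U∩T⊆D₃ : U ∩ T ⊆ᵛ D₂ ∪ (U ∩ ∁ T)
            U∩T⊆D₃ y = ∪-introˡ D₂ (U ∩ ∁ T) y ∘ ∪-introʳ ｛ v ｝ D₁ y ∘ ∪-introʳ ∅ (U ∩ T) y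

    fix-colouring : ∀ {x c} → S x ≡ true → c ∈ L x → Σ (LColouring G S L) λ φ → proj₁ φ x ≡ c
    fix-colouring {x} {c} Sx c∈Lx =
      let φ , φ-col = colour-in-phases ｛ x ｝ M A spare-T spare-v rest
      in (φ , isLColoring M⊆L φ-col) , φx≡c (IsColouringOn.from-lists φ-col x Sx)
      where
        M A : Fin n → List ℕ
        M = updateAt L x (λ _ → [ c ])
        A _ = []
        open ListColouring G M A

        M-x : M x ≡ [ c ]
        M-x = updateAt-updates x L

        M-y : ∀ y → y ≢ x → M y ≡ L y
        M-y y y≢x = updateAt-minimal y x L y≢x

        spare-x : ∀ {D} → D ⊆ᵛ ｛ x ｝ → HasSpareColour x D
        spare-x {D} D⊆x rewrite M-x = [] ∷ [] , s≤s (count≤length no-coloured-neighbour)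
          where
            no-coloured-neighbour : ∀ y → (D ∩ adj G x) y ≡ true → y ∈ []
            no-coloured-neighbour y y∈ with ∈-｛｝ x y (D⊆x y (∩-elimˡ D (adj G x) y y∈))
            ... | refl = contradiction (trans (sym (∩-elimʳ D (adj G x) y y∈)) (irrefl G y)) λ ()

        spare-T : ∀ y → (U ∩ ｛ x ｝) y ≡ true → ∀ {D} → D ⊆ᵛ U ∩ ｛ x ｝ → HasSpareColour y D
        spare-T y y∈ D⊆ with ∈-｛｝ x y (∩-elimʳ U ｛ x ｝ y y∈)
        ... | refl = spare-x (λ z → ∩-elimʳ U ｛ x ｝ z ∘ D⊆ z)

        spare-v : ∀ {D} → D ⊆ᵛ U ∩ ｛ x ｝ → HasSpareColour v D
        spare-v {D} D⊆ with v ≟ x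
        ... | yes refl = spare-x (λ z → ∩-elimʳ U ｛ x ｝ z ∘ D⊆ z)
        ... | no v≢x rewrite M-y v v≢x = L! v v∈S , ≤-trans (s≤s (≤-trans at-most-x (s≤s z≤n))) 3≤|L-v|
          where
            at-most-x : count (D ∩ adj G v) ≤ length [ x ]
            at-most-x = count≤length {ys = [ x ]} λ y y∈ →
              here (∈-｛｝ x y (∩-elimʳ U ｛ x ｝ y (D⊆ y (∩-elimˡ D (adj G v) y y∈))))

        rest : ∀ y → ｛ x ｝ y ≡ false → M y ≡ L y × A y ≡ []
        rest y y∉ = M-y y (∉-｛｝ x y y∉) , refl

        M⊆L : ∀ y → S y ≡ true → M y ⊆ L y
        M⊆L y _ with y ≟ x
        ... | yes refl rewrite M-x = λ { (here refl) → c∈Lx }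
        ... | no y≢x rewrite M-y y y≢x = λ d∈ → d∈

        φx≡c : ∀ {d} → d ∈ M x × d ∉ A x → d ≡ c
        φx≡c (d∈Mx , _) rewrite M-x with d∈Mx
        ... | here d≡c = d≡c

    forb-colouring : ∀ {a b} c → S a ≡ true → S b ≡ true →
                     Σ (LColouring G S L) λ φ → proj₁ φ a ≢ c × proj₁ φ b ≢ c
    forb-colouring {a} {b} c Sa Sb =
      let φ , φ-col = colour-in-phases T L A spare-T spare-v rest
      in (φ , isLColoring (λ _ _ d∈ → d∈) φ-col) , avoids φ-col a Sa a∈T , avoids φ-col b Sb b∈T
      where
        T : VSet n
        T = ｛ a ｝ ∪ ｛ b ｝

        A : Fin n → List ℕ
        A y = if T y then [ c ] else []
        open ListColouring G L A

        a∈T : T a ≡ true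
        a∈T = ∪-introˡ ｛ a ｝ ｛ b ｝ a (x∈｛x｝ a)

        b∈T : T b ≡ true
        b∈T = ∪-introʳ ｛ a ｝ ｛ b ｝ b (x∈｛x｝ b)

        A-T : ∀ y → T y ≡ true → A y ≡ [ c ]
        A-T y Ty rewrite Ty = refl

        rest : ∀ y → T y ≡ false → L y ≡ L y × A y ≡ []
        rest y Ty rewrite Ty = refl , refl

        |T|≤2 : count T ≤ 2
        |T|≤2 = count≤length {ys = a ∷ b ∷ []} λ y y∈T → case ∈-｛｝∪ a ｛ b ｝ y y∈T of λ
          { (inj₁ y≡a) → here y≡a
          ; (inj₂ (_ , y∈b)) → there (here (∈-｛｝ b y y∈b)) }

        spare-T : ∀ y → (U ∩ T) y ≡ true → ∀ {D} → D ⊆ᵛ U ∩ T → HasSpareColour y D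
        spare-T y y∈ D⊆ with Uy ← ∩-elimˡ U T y y∈ rewrite A-T y (∩-elimʳ U T y y∈) | |L-U| y Uy =
          L! y (U⊆S y Uy) , s≤s (coloured-<-degIn y Uy (λ z → ∩-elimˡ U T z ∘ D⊆ z))

        -- v has its own forbidden colour only if v ∈ T, and then at most one vertex of T lies in U.
        spare-v : ∀ {D} → D ⊆ᵛ U ∩ T → HasSpareColour v D
        spare-v {D} D⊆ =
          L! v v∈S , ≤-trans (s≤s (≤-trans (ℕP.+-monoʳ-≤ (length (A v)) coloured≤) (by-T (T v) refl))) 3≤|L-v|
          where
            coloured≤ : count (D ∩ adj G v) ≤ count (U ∩ T)
            coloured≤ = count-mono-≤ (λ y → D⊆ y ∘ ∩-elimˡ D (adj G v) y)
            by-T : ∀ t → T v ≡ t → length (A v) + count (U ∩ T) ≤ 2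
            by-T true Tv rewrite A-T v Tv = ≤-trans (count-mono-< (∩-elimʳ U T) (cong (_∧ T v) v∉U) Tv) |T|≤2
            by-T false Tv rewrite Tv = ≤-trans (count-mono-≤ (∩-elimʳ U T)) |T|≤2

        avoids : ∀ {φ} → IsColouringOn φ S → ∀ y → S y ≡ true → T y ≡ true → φ y ≢ c
        avoids φ-col y Sy Ty φy≡c with IsColouringOn.from-lists φ-col y Sy
        ... | _ , φy∉Ay rewrite A-T y Ty = φy∉Ay (here φy≡c)

    vertices : List (Fin n)
    vertices = members S

    |vertices|≤6 : length vertices ≤ 6
    |vertices|≤6 = begin
      length (members S)         ≡⟨ count≡length-members S ⟨
      count S                    ≤⟨ count≤length S⊆v∷U ⟩
      suc (length (members U))   ≡⟨ cong suc (count≡length-members U) ⟨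
      suc (count U)              ≤⟨ s≤s (count-mono-≤ U⊆N) ⟩
      suc (deg G v)              ≤⟨ s≤s deg-v≤5 ⟩
      6                          ∎
      where
        open ℕP.≤-Reasoning
        S⊆v∷U : ∀ y → S y ≡ true → y ∈ v ∷ members U
        S⊆v∷U y Sy with ∈-｛｝∪ v U y Sy
        ... | inj₁ y≡v = here y≡v
        ... | inj₂ (_ , Uy) = there (∈-members⁺ Uy)

    fixings : List (LColouring G S L)
    fixings = concatWith∈ vertices λ {x} x∈V → concatWith∈ (L x) λ c∈Lx →
      [ proj₁ (fix-colouring (∈-members⁻ x∈V) c∈Lx) ]

    forbiddings : List (LColouring G S L)
    forbiddings = concatWith∈ vertices λ {a} a∈V → concatWith∈ vertices λ {b} b∈V → concatWith∈ (L a ++ L b) λ {c} _ →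
      [ proj₁ (forb-colouring c (∈-members⁻ a∈V) (∈-members⁻ b∈V)) ]

    covering : CoveringFamily G S L 311
    covering = record
      { colourings = fixings ++ forbiddings
      ; nonempty   = Any⇒≢[] (fixing v (proj₁ some-c) v∈S (proj₂ some-c))
      ; size       = ≤-trans (ℕP.≤-reflexive (length-++ fixings)) (ℕP.+-mono-≤ |fixings| |forbiddings|)
      ; fixing     = fixing
      ; forbidding = forbidding
      }
      where
        fixing : ∀ x c → S x ≡ true → c ∈ L x → Any (λ φ → proj₁ φ x ≡ c) (fixings ++ forbiddings)
        fixing x c Sx c∈Lx = Any.++⁺ˡ (Any-concatWith∈⁺ vertices _ x∈V (Any-concatWith∈⁺ (L x) _ c∈Lx
          (here (proj₂ (fix-colouring (∈-members⁻ x∈V) c∈Lx)))))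
          where
            x∈V : x ∈ vertices
            x∈V = ∈-members⁺ Sx

        forbidding : ∀ a b c → S a ≡ true → S b ≡ true → c ∈ L a ++ L b →
                     Any (λ φ → proj₁ φ a ≢ c × proj₁ φ b ≢ c) (fixings ++ forbiddings)
        forbidding a b c Sa Sb c∈ = Any.++⁺ʳ fixings (Any-concatWith∈⁺ vertices _ a∈V (Any-concatWith∈⁺ vertices _ b∈V
          (Any-concatWith∈⁺ (L a ++ L b) _ c∈ (here (proj₂ (forb-colouring c (∈-members⁻ a∈V) (∈-members⁻ b∈V)))))))
          where
            a∈V : a ∈ vertices
            a∈V = ∈-members⁺ Sa
            b∈V : b ∈ vertices
            b∈V = ∈-members⁺ Sb

        some-c : ∃ (_∈ L v)
        some-c = 1≤length⇒∃∈ (≤-trans (s≤s z≤n) 3≤|L-v|)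

        |fixings| : length fixings ≤ 6 ℕ.* (4 ℕ.* 1)
        |fixings| = ≤-trans
          (length-concatWith∈-≤ vertices _ λ {x} x∈V → ≤-trans (length-concatWith∈-≤ (L x) _ λ _ → ℕP.≤-refl)
                                                          (ℕP.*-monoˡ-≤ 1 (|L|≤4 x (∈-members⁻ x∈V))))
          (ℕP.*-monoˡ-≤ (4 ℕ.* 1) |vertices|≤6)

        |forbiddings| : length forbiddings ≤ 6 ℕ.* (6 ℕ.* (8 ℕ.* 1))
        |forbiddings| = ≤-trans
          (length-concatWith∈-≤ vertices _ λ {a} a∈V → ≤-trans
            (length-concatWith∈-≤ vertices _ λ {b} b∈V → ≤-trans (length-concatWith∈-≤ (L a ++ L b) _ λ _ → ℕP.≤-refl)
              (ℕP.*-monoˡ-≤ 1 (≤-trans (ℕP.≤-reflexive (length-++ (L a)))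
                (ℕP.+-mono-≤ (|L|≤4 a (∈-members⁻ a∈V)) (|L|≤4 b (∈-members⁻ b∈V))))))
            (ℕP.*-monoˡ-≤ (8 ℕ.* 1) |vertices|≤6))
          (ℕP.*-monoˡ-≤ (6 ℕ.* (8 ℕ.* 1)) |vertices|≤6)

  reducible : Reducible G S 1/[1+ 311 ]
  reducible = reducible-from-covering 311 covering

-- ξ = + 1 / 2 ^ 48 normalises to 1/[1+ 2 ^ 48 ∸ 1 ].
ξ≤1/[1+311] : ξ ℚ.≤ 1/[1+ 311 ]
ξ≤1/[1+311] = 1/[1+]-antimono (ℕP.≤ᵇ⇒≤ 311 (2 ℕ.^ 48 ∸ 1) tt)

lemma4p3 : ∀ (n : ℕ) (G : Graph n) →
    (∀ (S : VSet n) → NonEmpty S → ¬ Reducible G S ξ) →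
    ∀ (v : Fin n) → (deg G v ≡ 3 ⊎ deg G v ≡ 4 ⊎ deg G v ≡ 5) →
    count (λ w → adj G v w ∧ (deg G w ≡ᵇ 3)) ≤ deg G v ∸ 2
lemma4p3 n G irreducible v deg-v = ℕP.≮⇒≥ {deg G v ∸ 2} {count U} λ d∸2<|U| →
  let open CubicNeighbours G v U (∩-elimˡ (adj G v) cubic) U-cubic
                           (≤-trans (d∸1≤1+[d∸2] (deg G v)) d∸2<|U|) (≤5 deg-v)
  in irreducible S (v , v∈S) (reducible-mono {G = G} {S} ξ≤1/[1+311] reducible)
  where
    cubic : VSet n
    cubic w = deg G w ≡ᵇ 3

    U : VSet n
    U = adj G v ∩ cubic

    U-cubic : ∀ u → U u ≡ true → deg G u ≡ 3
    U-cubic u Uu = ℕP.≡ᵇ⇒≡ (deg G u) 3 (Equivalence.from T-≡ (∩-elimʳ (adj G v) cubic u Uu))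

    d∸1≤1+[d∸2] : ∀ d → d ∸ 1 ≤ suc (d ∸ 2)
    d∸1≤1+[d∸2] 0 = z≤n
    d∸1≤1+[d∸2] 1 = z≤n
    d∸1≤1+[d∸2] (suc (suc d)) = ℕP.≤-refl

    ≤5 : ∀ {d} → d ≡ 3 ⊎ d ≡ 4 ⊎ d ≡ 5 → d ≤ 5
    ≤5 (inj₁ refl) = ℕP.m≤m+n 3 2
    ≤5 (inj₂ (inj₁ refl)) = ℕP.m≤m+n 4 1
    ≤5 (inj₂ (inj₂ refl)) = ℕP.≤-refl
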